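{- Let $1\le \ell\le m\le n$ be integers and $\mu=2^m1^{n-m}$ (the partition with conjugate $\mu'=(n,m)$). For $T\in\binom{[n+m]}{n}$ let $v_T\in M^\mu$ be the column tabloid whose first column consists of the elements of $T$ in increasing order and whose second column consists of the elements of $[n+m]\setminus T$ in increasing order; the $v_T$ form a basis of $M^\mu$, and for $v\in M^\mu$ let $\langle v,v_T\rangle$ denote the coefficient of $v_T$ in the expansion of $v$ in this basis. Then for all $S,T\in\binom{[n+m]}{n}$: \[ \langle \eta_\ell(v_S),v_T\rangle=\begin{cases}\binom{m}{\ell} & \text{if } S=T,\\ 0 & \text{if } S\ne T \text{ and } |S\cap T|\ne n-\ell,\\ (-1)^{\sum_{k=1}^{\ell}(c_k+d_k)+\ell+1} & \text{if } |S\cap T|=n-\ell, \text{ where } S\setminus T=\{c_1,\dots,c_\ell\},\ T\setminus S=\{d_1,\dots,d_\ell\}.\end{cases}\]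
   Context: For a partition $\lambda$ of $N$, a Young tableau of shape $\lambda$ is a filling of the Young diagram of $\lambda$ with distinct entries from $[N]=\{1,\dots,N\}$; $\mathcal T_\lambda$ is the set of such tableaux. $M^\lambda$ is the complex vector space generated by $\mathcal T_\lambda$ subject only to the column relations $t+s$, where $s$ is obtained from $t$ by swapping two entries in the same column; the class of $t$ is denoted $[t]$ (a column tabloid). For $\mu=2^m1^{n-m}$ (first column of length $n$, second of length $m$) and $\ell\in[m]$, the linear map $\eta_\ell:M^\mu\to M^\mu$ is defined by $\eta_\ell[t]=\binom{m}{\ell}[t]-\sum[s]$, where the sum ranges over all tableaux $s$ obtained from $t$ by choosing $\ell$ positions $i_1<\dots<i_\ell$ in the first column and $\ell$ positions $j_1<\dots<j_\ell$ in the second column and exchanging the entry at position $i_k$ of the first column with the entry at position $j_k$ of the second column for each $k$ (i.e. swapping $\ell$ entries of the second column with $\ell$ entries of the first column, preserving the vertical order of each set of $\ell$ entries). -}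

module Defs where

open import Data.Bool using (Bool; true; false; if_then_else_)
open import Data.Nat using (ℕ; zero; suc; _+_)
open import Data.Nat.Combinatorics using (_C_)
open import Data.Fin using (Fin; zero; suc; toℕ; _<?_)
open import Data.List using (List; []; _∷_; map; _++_; foldr; length; filter)
open import Data.Vec using (Vec; []; _∷_)
open import Data.Vec.Properties using (≡-dec)
open import Data.Fin.Subset using (Subset; ⁅_⁆; _∪_; ⊥; ∁)
open import Data.Integer using (ℤ; +_; -_; _*_; _-_)
import Data.Integer as ℤ
import Data.Bool as B
open import Relation.Nullary.Decidable using (does)

-- Entries of [N] = {1,…,N} are represented by Fin N (element i ↦ toℕ i + 1).

elems : ∀ {N} → Subset N → List (Fin N)
elems []          = []
elems (true ∷ p)  = zero ∷ map suc (elems p)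
elems (false ∷ p) = map suc (elems p)

entrySet : ∀ {N} → List (Fin N) → Subset N
entrySet = foldr (λ x s → ⁅ x ⁆ ∪ s) ⊥

-- A Young tableau of shape μ = 2^m 1^(n-m): its first column and its
-- second column, each listed from top to bottom.
record Tableau (N : ℕ) : Set where
  constructor tab
  field
    col1 : List (Fin N)
    col2 : List (Fin N)
open Tableau public

inversions : ∀ {N} → List (Fin N) → ℕ
inversions []       = 0
inversions (x ∷ xs) = length (filter (λ y → y <? x) xs) + inversions xs

sgn : ℕ → ℤ
sgn zero    = + 1
sgn (suc k) = - sgn k

sumℤ : List ℤ → ℤ
sumℤ = foldr ℤ._+_ (+ 0)

sumℕ : List ℕ → ℕ
sumℕ = foldr _+_ 0

-- Elements of M^μ (N = n + m) are represented by their coordinate vectors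
-- in the basis (v_T)_T, T ⊆ [N] with |T| = n:  ⟨v , v_T⟩ = v T.
Mμ : ℕ → Set
Mμ N = Subset N → ℤ

_≟S_ : ∀ {N} → (S T : Subset N) → Bool
S ≟S T = does (≡-dec B._≟_ S T)

-- The column tabloid [t] ∈ M^μ: sorting each column by the column relations
-- gives [t] = (-1)^{inv(col1)+inv(col2)} v_{entries of col1}.
[_] : ∀ {N} → Tableau N → Mμ N
[ t ] T = if entrySet (col1 t) ≟S T
            then sgn (inversions (col1 t) + inversions (col2 t))
            else + 0

tabOf : ∀ {N} → Subset N → Tableau N
tabOf S = tab (elems S) (elems (∁ S))

v : ∀ {N} → Subset N → Mμ N
v S = [ tabOf S ]

-- All choices of k positions among n positions, as boolean masks of length n
-- (position i chosen iff the i-th entry is true); positions are increasing.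
choose : ℕ → ℕ → List (List Bool)
choose zero    zero    = [] ∷ []
choose zero    (suc k) = []
choose (suc n) zero    = map (false ∷_) (choose n zero)
choose (suc n) (suc k) = map (false ∷_) (choose n (suc k)) ++ map (true ∷_) (choose n k)

select : ∀ {A : Set} → List Bool → List A → List A
select (true ∷ bs)  (x ∷ xs) = x ∷ select bs xs
select (false ∷ bs) (x ∷ xs) = select bs xs
select _ _ = []

replace : ∀ {A : Set} → List Bool → List A → List A → List A
replace (true ∷ bs)  (x ∷ xs) (r ∷ rs) = r ∷ replace bs xs rs
replace (true ∷ bs)  (x ∷ xs) []       = x ∷ replace bs xs []
replace (false ∷ bs) (x ∷ xs) rs       = x ∷ replace bs xs rs
replace []           xs       _        = xs
replace (_ ∷ _)      []       _        = []

-- exchange the entry at position i_k of column 1 with the entry at position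
-- j_k of column 2, for each k (I, J the masks of i_1<…<i_ℓ and j_1<…<j_ℓ)
swapTab : ∀ {N} → List Bool → List Bool → Tableau N → Tableau N
swapTab I J (tab c1 c2) = tab (replace I c1 (select J c2)) (replace J c2 (select I c1))

η : (n m ℓ : ℕ) → Tableau (n + m) → Mμ (n + m)
η n m ℓ t T =
  (+ (m C ℓ)) * [ t ] T
  - sumℤ (foldr (λ I acc → map (λ J → [ swapTab I J t ] T) (choose m ℓ) ++ acc) [] (choose n ℓ))

elemSum : ∀ {N} → Subset N → ℕ
elemSum S = sumℕ (map (λ i → suc (toℕ i)) (elems S))

-- Only one swap can move the first column of v_S onto T, namely the one exchanging
-- S ─ T = {c₁ < ⋯ < c_ℓ} with T ─ S = {d₁ < ⋯ < d_ℓ}; so ⟨η_ℓ v_S, v_T⟩ is (m choose ℓ)·[S = T]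
-- minus at most one signed term, present exactly when ∣S ─ T∣ = ℓ.  Its sign is the parity of the
-- inversions of the two swapped columns.  Putting d_k into the slot of c_k inverts it with the fixed
-- entries of its column strictly between c_k and d_k, so modulo 2 the two columns together have
-- Σ_k (rank c_k + rank d_k) inversions, ranks taken among the entries outside X = (S ─ T) ∪ (T ─ S).
-- Since the j-th smallest element of X is j plus the number of entries outside X below it, this is
-- Σ c_k + Σ d_k − (1 + ⋯ + 2ℓ) ≡ Σ c_k + Σ d_k + ℓ.

module Submission where

open import Algebra.Bundles using (CommutativeMonoid)
import Algebra.Properties.CommutativeSemigroup as CommutativeSemigroupProperties
open import Data.Bool using (Bool; true; false; not; if_then_else_)
import Data.Bool as Bool
open import Data.Fin using (Fin; zero; suc; toℕ; _<_; _<?_)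
open import Data.Fin.Properties using (<-asym; <-cmp)
open import Data.Fin.Subset using (Subset; ∣_∣; _∩_; _∪_; _─_; ∁; ⁅_⁆; _⊆_; _∈_)
open import Data.Fin.Subset.Properties
  using (∪-identityˡ; ∪-assoc; ∪-commutativeMonoid; ∩-comm; drop-∷-⊆; x∈p⇒x∉∁p; x∉p⇒x∈∁p; ∣∁p∣≡n∸∣p∣)
open import Data.Integer using (ℤ; +_; -_; _-_) renaming (_+_ to _+ℤ_; _*_ to _*ℤ_)
import Data.Integer.Properties as ℤ
open import Data.List using (List; []; _∷_; map; _++_; foldr; length; filter)
open import Data.List.Properties
  using (map-++; map-∘; length-map; length-++; filter-++; filter-all; filter-none; filter-accept; filter-reject; ∷-injectiveʳ)
open import Data.List.Relation.Unary.All as All using (All; []; _∷_)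
open import Data.List.Relation.Unary.Any using (here; there)
open import Data.List.Membership.Propositional using () renaming (_∈_ to _∈ₗ_)
open import Data.List.Membership.Propositional.Properties using (∈-map⁻)
import Data.List.Relation.Unary.All.Properties as All
open import Data.List.Relation.Unary.AllPairs as AllPairs using (AllPairs; []; _∷_)
import Data.List.Relation.Unary.AllPairs.Properties as AllPairs
open import Data.List.Relation.Binary.Permutation.Propositional as ↭ using (_↭_)
open import Data.List.Relation.Binary.Permutation.Propositional.Properties using (shift; ↭-length; filter-↭)
open import Data.Nat using (ℕ; zero; suc; _+_; _*_; _∸_; _≤_; s≤s; z≤n)
open import Data.Nat.Properties
  using (+-identityʳ; +-suc; +-assoc; +-comm; suc-injective; ≤-trans; m+n∸m≡n; m+n∸n≡m; m∸[m∸n]≡n; <⇒≢)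
open import Data.Nat.Tactic.RingSolver using (solve-∀)
open import Data.Nat.Combinatorics using (_C_)
open import Data.Product using (_×_; _,_; proj₁; proj₂)
import Data.Product as Product
open import Data.Vec using ([]; _∷_; here; there; tail)
open import Data.Vec.Properties using (≡-dec)
open import Function using (_∘_)
open import Relation.Binary.PropositionalEquality
  using (_≡_; _≢_; refl; sym; trans; cong; cong₂; subst; module ≡-Reasoning)
open import Relation.Binary.Definitions using (tri<; tri≈; tri>)
open import Relation.Nullary using (does; contradiction)
open import Relation.Nullary.Decidable using (dec-true; dec-false)

open import Defs

sgn-+ : ∀ a b → sgn (a + b) ≡ sgn a *ℤ sgn b
sgn-+ zero    b = sym (ℤ.*-identityˡ (sgn b))
sgn-+ (suc a) b = trans (cong -_ (sgn-+ a b)) (ℤ.neg-distribˡ-* (sgn a) (sgn b))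

sgn-double : ∀ k → sgn (k + k) ≡ + 1
sgn-double zero    = refl
sgn-double (suc k) rewrite +-suc k k = trans (ℤ.neg-involutive _) (sgn-double k)

sgn-+-double : ∀ a k → sgn (a + (k + k)) ≡ sgn a
sgn-+-double a k = begin
  sgn (a + (k + k))     ≡⟨ sgn-+ a (k + k) ⟩
  sgn a *ℤ sgn (k + k)  ≡⟨ cong (sgn a *ℤ_) (sgn-double k) ⟩
  sgn a *ℤ + 1          ≡⟨ ℤ.*-identityʳ (sgn a) ⟩
  sgn a                 ∎
  where open ≡-Reasoning

sgn-+-cong : ∀ {a b c d} → sgn a ≡ sgn c → sgn b ≡ sgn d → sgn (a + b) ≡ sgn (c + d)
sgn-+-cong {a} {b} {c} {d} a≈c b≈d =
  trans (sgn-+ a b) (trans (cong₂ _*ℤ_ a≈c b≈d) (sym (sgn-+ c d)))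

sgn-+-congˡ : ∀ a {b c} → sgn b ≡ sgn c → sgn (a + b) ≡ sgn (a + c)
sgn-+-congˡ a {b} {c} = sgn-+-cong {a} {b} {a} {c} refl

-- Sums over all choices of positions

weight : List Bool → ℕ
weight []           = 0
weight (true ∷ bs)  = suc (weight bs)
weight (false ∷ bs) = weight bs

Mask : ℕ → ℕ → List Bool → Set
Mask n k I = length I ≡ n × weight I ≡ k

sumℤ-++ : ∀ xs ys → sumℤ (xs ++ ys) ≡ sumℤ xs +ℤ sumℤ ys
sumℤ-++ []       ys = sym (ℤ.+-identityˡ (sumℤ ys))
sumℤ-++ (x ∷ xs) ys = trans (cong (x +ℤ_) (sumℤ-++ xs ys)) (sym (ℤ.+-assoc x (sumℤ xs) (sumℤ ys)))

sumℤ-foldr-++ : ∀ {A B : Set} (g : A → B → ℤ) (as : List A) (bs : List B) →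
  sumℤ (foldr (λ a acc → map (g a) bs ++ acc) [] as) ≡ sumℤ (map (λ a → sumℤ (map (g a) bs)) as)
sumℤ-foldr-++ g []       bs = refl
sumℤ-foldr-++ g (a ∷ as) bs =
  trans (sumℤ-++ (map (g a) bs) _) (cong (sumℤ (map (g a) bs) +ℤ_) (sumℤ-foldr-++ g as bs))

sumℤ-map-∷ : ∀ (f : List Bool → ℤ) b Is → sumℤ (map f (map (b ∷_) Is)) ≡ sumℤ (map (f ∘ (b ∷_)) Is)
sumℤ-map-∷ f b Is = cong sumℤ (sym (map-∘ Is))

sum-choose-suc : ∀ n k (f : List Bool → ℤ) →
  sumℤ (map f (choose (suc n) (suc k))) ≡
  sumℤ (map (f ∘ (false ∷_)) (choose n (suc k))) +ℤ sumℤ (map (f ∘ (true ∷_)) (choose n k))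
sum-choose-suc n k f = begin
  sumℤ (map f (map (false ∷_) F ++ map (true ∷_) T))
    ≡⟨ cong sumℤ (map-++ f (map (false ∷_) F) _) ⟩
  sumℤ (map f (map (false ∷_) F) ++ map f (map (true ∷_) T))
    ≡⟨ sumℤ-++ (map f (map (false ∷_) F)) _ ⟩
  sumℤ (map f (map (false ∷_) F)) +ℤ sumℤ (map f (map (true ∷_) T))
    ≡⟨ cong₂ _+ℤ_ (sumℤ-map-∷ f false F) (sumℤ-map-∷ f true T) ⟩
  sumℤ (map (f ∘ (false ∷_)) F) +ℤ sumℤ (map (f ∘ (true ∷_)) T) ∎
  where
  open ≡-Reasoning
  F = choose n (suc k)
  T = choose n k

sum-choose-vanishing : ∀ n k (f : List Bool → ℤ) →
  (∀ I → Mask n k I → f I ≡ + 0) → sumℤ (map f (choose n k)) ≡ + 0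
sum-choose-vanishing zero    zero    f f≡0 = cong (_+ℤ + 0) (f≡0 [] (refl , refl))
sum-choose-vanishing zero    (suc k) f f≡0 = refl
sum-choose-vanishing (suc n) zero    f f≡0 =
  trans (sumℤ-map-∷ f false (choose n zero))
        (sum-choose-vanishing n zero _ λ I (l , w) → f≡0 (false ∷ I) (cong suc l , w))
sum-choose-vanishing (suc n) (suc k) f f≡0 = trans (sum-choose-suc n k f) (cong₂ _+ℤ_
  (sum-choose-vanishing n (suc k) _ λ I (l , w) → f≡0 (false ∷ I) (cong suc l , w))
  (sum-choose-vanishing n k       _ λ I (l , w) → f≡0 (true ∷ I) (cong suc l , cong suc w)))

sum-choose-single : ∀ n k (f : List Bool → ℤ) {I₀} → Mask n k I₀ →
  (∀ I → Mask n k I → I ≢ I₀ → f I ≡ + 0) → sumℤ (map f (choose n k)) ≡ f I₀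
sum-choose-single zero    zero    f {[]}         _       f≡0 = ℤ.+-identityʳ (f [])
sum-choose-single (suc n) zero    f {false ∷ I₀} (l , w) f≡0 =
  trans (sumℤ-map-∷ f false (choose n zero))
        (sum-choose-single n zero _ (suc-injective l , w)
          λ I (l′ , w′) I≢I₀ → f≡0 (false ∷ I) (cong suc l′ , w′) (I≢I₀ ∘ ∷-injectiveʳ))
sum-choose-single (suc n) (suc k) f {false ∷ I₀} (l , w) f≡0 =
  trans (sum-choose-suc n k f) (trans (cong₂ _+ℤ_
    (sum-choose-single n (suc k) _ (suc-injective l , w)
      λ I (l′ , w′) I≢I₀ → f≡0 (false ∷ I) (cong suc l′ , w′) (I≢I₀ ∘ ∷-injectiveʳ))
    (sum-choose-vanishing n k _ λ I (l′ , w′) → f≡0 (true ∷ I) (cong suc l′ , cong suc w′) λ ()))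
    (ℤ.+-identityʳ _))
sum-choose-single (suc n) (suc k) f {true ∷ I₀}  (l , w) f≡0 =
  trans (sum-choose-suc n k f) (trans (cong₂ _+ℤ_
    (sum-choose-vanishing n (suc k) _ λ I (l′ , w′) → f≡0 (false ∷ I) (cong suc l′ , w′) λ ())
    (sum-choose-single n k _ (suc-injective l , suc-injective w)
      λ I (l′ , w′) I≢I₀ → f≡0 (true ∷ I) (cong suc l′ , cong suc w′) (I≢I₀ ∘ ∷-injectiveʳ)))
    (ℤ.+-identityˡ _))

-- Subsets and masks

length-elems : ∀ {N} (X : Subset N) → length (elems X) ≡ ∣ X ∣
length-elems []          = refl
length-elems (true ∷ X)  = cong suc (trans (length-map suc (elems X)) (length-elems X))
length-elems (false ∷ X) = trans (length-map suc (elems X)) (length-elems X)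

∈-elems : ∀ {N} (X : Subset N) {x} → x ∈ₗ elems X → x ∈ X
∈-elems (true ∷ X) (here refl) = here
∈-elems (true ∷ X) (there x∈) with ∈-map⁻ suc x∈
... | _ , y∈ , refl = there (∈-elems X y∈)
∈-elems (false ∷ X) x∈ with ∈-map⁻ suc x∈
... | _ , y∈ , refl = there (∈-elems X y∈)

elems-sorted : ∀ {N} (X : Subset N) → AllPairs _<_ (elems X)
elems-sorted []          = []
elems-sorted (true ∷ X)  =
  All.map⁺ (All.universal (λ _ → s≤s z≤n) (elems X)) ∷ AllPairs.map⁺ (AllPairs.map s≤s (elems-sorted X))
elems-sorted (false ∷ X) = AllPairs.map⁺ (AllPairs.map s≤s (elems-sorted X))

entrySet-++ : ∀ {N} (xs ys : List (Fin N)) → entrySet (xs ++ ys) ≡ entrySet xs ∪ entrySet ys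
entrySet-++ []       ys = sym (∪-identityˡ (entrySet ys))
entrySet-++ (x ∷ xs) ys = trans (cong (⁅ x ⁆ ∪_) (entrySet-++ xs ys)) (sym (∪-assoc ⁅ x ⁆ _ _))

entrySet-↭ : ∀ {N} {xs ys : List (Fin N)} → xs ↭ ys → entrySet xs ≡ entrySet ys
entrySet-↭ ↭.refl          = refl
entrySet-↭ (↭.prep x p)    = cong (⁅ x ⁆ ∪_) (entrySet-↭ p)
entrySet-↭ {N} (↭.swap x y p) =
  trans (cong (λ E → ⁅ x ⁆ ∪ (⁅ y ⁆ ∪ E)) (entrySet-↭ p)) (x∙yz≈y∙xz ⁅ x ⁆ ⁅ y ⁆ _)
  where open CommutativeSemigroupProperties (CommutativeMonoid.commutativeSemigroup (∪-commutativeMonoid N))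
entrySet-↭ (↭.trans p q)   = trans (entrySet-↭ p) (entrySet-↭ q)

entrySet-map-suc : ∀ {N} (xs : List (Fin N)) → entrySet (map suc xs) ≡ false ∷ entrySet xs
entrySet-map-suc []       = refl
entrySet-map-suc (x ∷ xs) = cong (⁅ suc x ⁆ ∪_) (entrySet-map-suc xs)

entrySet-elems : ∀ {N} (X : Subset N) → entrySet (elems X) ≡ X
entrySet-elems []          = refl
entrySet-elems (true ∷ X)  =
  trans (cong (⁅ zero ⁆ ∪_) (entrySet-map-suc (elems X))) (cong (true ∷_) (trans (∪-identityˡ _) (entrySet-elems X)))
entrySet-elems (false ∷ X) = trans (entrySet-map-suc (elems X)) (cong (false ∷_) (entrySet-elems X))

-- Masks over the increasing listing of a subset: selectₛ I X keeps the entries of X at the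
-- positions marked by I, and positions X Y marks the entries of Y ⊆ X.
selectₛ : ∀ {N} → List Bool → Subset N → Subset N
selectₛ _       []          = []
selectₛ I       (false ∷ X) = false ∷ selectₛ I X
selectₛ []      (true ∷ X)  = false ∷ selectₛ [] X
selectₛ (b ∷ I) (true ∷ X)  = b ∷ selectₛ I X

positions : ∀ {N} → Subset N → Subset N → List Bool
positions []          []      = []
positions (true ∷ X)  (y ∷ Y) = y ∷ positions X Y
positions (false ∷ X) (_ ∷ Y) = positions X Y

select-map : ∀ {A B : Set} (f : A → B) I (xs : List A) → select I (map f xs) ≡ map f (select I xs)
select-map f []          xs       = refl
select-map f (true ∷ I)  []       = refl
select-map f (false ∷ I) []       = refl
select-map f (true ∷ I)  (x ∷ xs) = cong (f x ∷_) (select-map f I xs)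
select-map f (false ∷ I) (x ∷ xs) = select-map f I xs

length-select : ∀ {A : Set} I (xs : List A) → length I ≡ length xs → length (select I xs) ≡ weight I
length-select []          []       _ = refl
length-select (true ∷ I)  (x ∷ xs) l = cong suc (length-select I xs (suc-injective l))
length-select (false ∷ I) (x ∷ xs) l = length-select I xs (suc-injective l)

All-select : ∀ {A : Set} {P : A → Set} I {xs : List A} → All P xs → All P (select I xs)
All-select []          _          = []
All-select (true ∷ I)  []         = []
All-select (false ∷ I) []         = []
All-select (true ∷ I)  (px ∷ pxs) = px ∷ All-select I pxs
All-select (false ∷ I) (_ ∷ pxs)  = All-select I pxs

select-elems : ∀ {N} I (X : Subset N) → length I ≡ ∣ X ∣ → select I (elems X) ≡ elems (selectₛ I X)
select-elems []          []          _ = refl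
select-elems (true ∷ I)  (true ∷ X)  l =
  cong (zero ∷_) (trans (select-map suc I (elems X)) (cong (map suc) (select-elems I X (suc-injective l))))
select-elems (false ∷ I) (true ∷ X)  l =
  trans (select-map suc I (elems X)) (cong (map suc) (select-elems I X (suc-injective l)))
select-elems I           (false ∷ X) l =
  trans (select-map suc I (elems X)) (cong (map suc) (select-elems I X l))

selectₛ-not : ∀ {N} I (X : Subset N) → length I ≡ ∣ X ∣ → selectₛ (map not I) X ≡ X ─ selectₛ I X
selectₛ-not []          []          _ = refl
selectₛ-not (true ∷ I)  (true ∷ X)  l = cong (false ∷_) (selectₛ-not I X (suc-injective l))
selectₛ-not (false ∷ I) (true ∷ X)  l = cong (true ∷_) (selectₛ-not I X (suc-injective l))
selectₛ-not I           (false ∷ X) l = cong (false ∷_) (selectₛ-not I X l)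

selectₛ-⊆ : ∀ {N} I (X : Subset N) → selectₛ I X ⊆ X
selectₛ-⊆ (b ∷ I) (true ∷ X)  here       = here
selectₛ-⊆ (b ∷ I) (true ∷ X)  (there x∈) = there (selectₛ-⊆ I X x∈)
selectₛ-⊆ []      (true ∷ X)  (there x∈) = there (selectₛ-⊆ [] X x∈)
selectₛ-⊆ I       (false ∷ X) (there x∈) = there (selectₛ-⊆ I X x∈)

length-positions : ∀ {N} (X Y : Subset N) → length (positions X Y) ≡ ∣ X ∣
length-positions []          []      = refl
length-positions (true ∷ X)  (_ ∷ Y) = cong suc (length-positions X Y)
length-positions (false ∷ X) (_ ∷ Y) = length-positions X Y

weight-positions : ∀ {N} {X Y : Subset N} → Y ⊆ X → weight (positions X Y) ≡ ∣ Y ∣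
weight-positions {X = []}        {[]}        _   = refl
weight-positions {X = true ∷ X}  {true ∷ Y}  Y⊆X = cong suc (weight-positions (drop-∷-⊆ Y⊆X))
weight-positions {X = true ∷ X}  {false ∷ Y} Y⊆X = weight-positions (drop-∷-⊆ Y⊆X)
weight-positions {X = false ∷ X} {false ∷ Y} Y⊆X = weight-positions (drop-∷-⊆ Y⊆X)
weight-positions {X = false ∷ X} {true ∷ Y}  Y⊆X = contradiction (Y⊆X here) λ ()

selectₛ-positions : ∀ {N} {X Y : Subset N} → Y ⊆ X → selectₛ (positions X Y) X ≡ Y
selectₛ-positions {X = []}        {[]}        _   = refl
selectₛ-positions {X = true ∷ X}  {y ∷ Y}     Y⊆X = cong (y ∷_) (selectₛ-positions (drop-∷-⊆ Y⊆X))
selectₛ-positions {X = false ∷ X} {false ∷ Y} Y⊆X = cong (false ∷_) (selectₛ-positions (drop-∷-⊆ Y⊆X))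
selectₛ-positions {X = false ∷ X} {true ∷ Y}  Y⊆X = contradiction (Y⊆X here) λ ()

positions-selectₛ : ∀ {N} I (X : Subset N) → length I ≡ ∣ X ∣ → positions X (selectₛ I X) ≡ I
positions-selectₛ []      []          _ = refl
positions-selectₛ (b ∷ I) (true ∷ X)  l = cong (b ∷_) (positions-selectₛ I X (suc-injective l))
positions-selectₛ I       (false ∷ X) l = positions-selectₛ I X l

select-positions : ∀ {N} {X Y : Subset N} → Y ⊆ X → select (positions X Y) (elems X) ≡ elems Y
select-positions {X = X} {Y} Y⊆X =
  trans (select-elems (positions X Y) X (length-positions X Y)) (cong elems (selectₛ-positions Y⊆X))

select-not-positions : ∀ {N} {X Y : Subset N} → Y ⊆ X →
  select (map not (positions X Y)) (elems X) ≡ elems (X ─ Y)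
select-not-positions {X = X} {Y} Y⊆X = begin
  select (map not I) (elems X)  ≡⟨ select-elems (map not I) X (trans (length-map not I) (length-positions X Y)) ⟩
  elems (selectₛ (map not I) X) ≡⟨ cong elems (selectₛ-not I X (length-positions X Y)) ⟩
  elems (X ─ selectₛ I X)       ≡⟨ cong (λ Z → elems (X ─ Z)) (selectₛ-positions Y⊆X) ⟩
  elems (X ─ Y)                 ∎
  where
  open ≡-Reasoning
  I = positions X Y

p─q⊆p : ∀ {N} (p q : Subset N) → p ─ q ⊆ p
p─q⊆p (true ∷ p) (false ∷ q) here       = here
p─q⊆p (_ ∷ p)    (false ∷ q) (there x∈) = there (p─q⊆p p q x∈)
p─q⊆p (_ ∷ p)    (true ∷ q)  (there x∈) = there (p─q⊆p p q x∈)

q─p⊆∁p : ∀ {N} (p q : Subset N) → q ─ p ⊆ ∁ p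
q─p⊆∁p (false ∷ p) (true ∷ q) here       = here
q─p⊆∁p (false ∷ p) (_ ∷ q)    (there x∈) = there (q─p⊆∁p p q x∈)
q─p⊆∁p (true ∷ p)  (_ ∷ q)    (there x∈) = there (q─p⊆∁p p q x∈)

p⊆∁∁p : ∀ {N} (p : Subset N) → p ⊆ ∁ (∁ p)
p⊆∁∁p p = x∉p⇒x∈∁p ∘ x∈p⇒x∉∁p

─-∪-cancel : ∀ {N} {S A B : Subset N} → A ⊆ S → B ⊆ ∁ S →
  S ─ ((S ─ A) ∪ B) ≡ A × ((S ─ A) ∪ B) ─ S ≡ B
─-∪-cancel {S = []}       {[]}       {[]}       _   _    = refl , refl
─-∪-cancel {S = true ∷ S} {true ∷ A} {false ∷ B} A⊆S B⊆∁S =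
  Product.map (cong (true ∷_)) (cong (false ∷_)) (─-∪-cancel (drop-∷-⊆ A⊆S) (drop-∷-⊆ B⊆∁S))
─-∪-cancel {S = true ∷ S} {false ∷ A} {false ∷ B} A⊆S B⊆∁S =
  Product.map (cong (false ∷_)) (cong (false ∷_)) (─-∪-cancel (drop-∷-⊆ A⊆S) (drop-∷-⊆ B⊆∁S))
─-∪-cancel {S = false ∷ S} {false ∷ A} {true ∷ B} A⊆S B⊆∁S =
  Product.map (cong (false ∷_)) (cong (true ∷_)) (─-∪-cancel (drop-∷-⊆ A⊆S) (drop-∷-⊆ B⊆∁S))
─-∪-cancel {S = false ∷ S} {false ∷ A} {false ∷ B} A⊆S B⊆∁S =
  Product.map (cong (false ∷_)) (cong (false ∷_)) (─-∪-cancel (drop-∷-⊆ A⊆S) (drop-∷-⊆ B⊆∁S))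
─-∪-cancel {S = true ∷ S}  {_}        {true ∷ B} _   B⊆∁S = contradiction (B⊆∁S here) λ ()
─-∪-cancel {S = false ∷ S} {true ∷ A} {_}        A⊆S _    = contradiction (A⊆S here) λ ()

p─[p─q]∪[q─p]≡q : ∀ {N} (p q : Subset N) → (p ─ (p ─ q)) ∪ (q ─ p) ≡ q
p─[p─q]∪[q─p]≡q []          []          = refl
p─[p─q]∪[q─p]≡q (true ∷ p)  (true ∷ q)  = cong (true ∷_) (p─[p─q]∪[q─p]≡q p q)
p─[p─q]∪[q─p]≡q (true ∷ p)  (false ∷ q) = cong (false ∷_) (p─[p─q]∪[q─p]≡q p q)
p─[p─q]∪[q─p]≡q (false ∷ p) (true ∷ q)  = cong (true ∷_) (p─[p─q]∪[q─p]≡q p q)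
p─[p─q]∪[q─p]≡q (false ∷ p) (false ∷ q) = cong (false ∷_) (p─[p─q]∪[q─p]≡q p q)

∣p─q∣+∣p∩q∣≡∣p∣ : ∀ {N} (p q : Subset N) → ∣ p ─ q ∣ + ∣ p ∩ q ∣ ≡ ∣ p ∣
∣p─q∣+∣p∩q∣≡∣p∣ []          []          = refl
∣p─q∣+∣p∩q∣≡∣p∣ (true ∷ p)  (true ∷ q)  = trans (+-suc _ _) (cong suc (∣p─q∣+∣p∩q∣≡∣p∣ p q))
∣p─q∣+∣p∩q∣≡∣p∣ (true ∷ p)  (false ∷ q) = cong suc (∣p─q∣+∣p∩q∣≡∣p∣ p q)
∣p─q∣+∣p∩q∣≡∣p∣ (false ∷ p) (true ∷ q)  = ∣p─q∣+∣p∩q∣≡∣p∣ p q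
∣p─q∣+∣p∩q∣≡∣p∣ (false ∷ p) (false ∷ q) = ∣p─q∣+∣p∩q∣≡∣p∣ p q

∣p─p∣≡0 : ∀ {N} (p : Subset N) → ∣ p ─ p ∣ ≡ 0
∣p─p∣≡0 []          = refl
∣p─p∣≡0 (true ∷ p)  = ∣p─p∣≡0 p
∣p─p∣≡0 (false ∷ p) = ∣p─p∣≡0 p

∣p─q∣≡∣p∣∸∣p∩q∣ : ∀ {N} (p q : Subset N) → ∣ p ─ q ∣ ≡ ∣ p ∣ ∸ ∣ p ∩ q ∣
∣p─q∣≡∣p∣∸∣p∩q∣ p q = trans (sym (m+n∸n≡m ∣ p ─ q ∣ ∣ p ∩ q ∣)) (cong (_∸ ∣ p ∩ q ∣) (∣p─q∣+∣p∩q∣≡∣p∣ p q))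

∣p∩q∣≡∣p∣∸∣p─q∣ : ∀ {N} (p q : Subset N) → ∣ p ∩ q ∣ ≡ ∣ p ∣ ∸ ∣ p ─ q ∣
∣p∩q∣≡∣p∣∸∣p─q∣ p q = trans (sym (m+n∸m≡n ∣ p ─ q ∣ ∣ p ∩ q ∣)) (cong (_∸ ∣ p ─ q ∣) (∣p─q∣+∣p∩q∣≡∣p∣ p q))

-- Ranks and inversions of columns

rank : ∀ {N} → List (Fin N) → Fin N → ℕ
rank U z = length (filter (_<? z) U)

rankSum : ∀ {N} → List (Fin N) → List (Fin N) → ℕ
rankSum U zs = sumℕ (map (rank U) zs)

rank-zero : ∀ {N} (U : List (Fin (suc N))) → rank U zero ≡ 0
rank-zero {N} U = cong length (filter-none (_<? zero {N}) (All.universal (λ _ ()) U))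

rank-above : ∀ {N} {U : List (Fin N)} {z} → All (z <_) U → rank U z ≡ 0
rank-above z<U = cong length (filter-none (_<? _) (All.map (λ z<u u<z → <-asym z<u u<z) z<U))

rank-map-suc : ∀ {N} (U : List (Fin N)) z → rank (map suc U) (suc z) ≡ rank U z
rank-map-suc []      z = refl
rank-map-suc (u ∷ U) z with does (u <? z)
... | true  = cong suc (rank-map-suc U z)
... | false = rank-map-suc U z

rank-++ : ∀ {N} (U V : List (Fin N)) z → rank (U ++ V) z ≡ rank U z + rank V z
rank-++ U V z = trans (cong length (filter-++ (_<? z) U V)) (length-++ (filter (_<? z) U))

rank+above≡length : ∀ {N} (x : Fin N) B → All (x ≢_) B → rank B x + length (filter (x <?_) B) ≡ length B
rank+above≡length x []      []           = refl
rank+above≡length x (b ∷ B) (x≢b ∷ x≢B) with <-cmp b x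
... | tri< b<x _ _ = trans
  (cong₂ _+_ (cong length (filter-accept (_<? x) b<x)) (cong length (filter-reject (x <?_) (<-asym b<x))))
  (cong suc (rank+above≡length x B x≢B))
... | tri≈ _ b≡x _ = contradiction (sym b≡x) x≢b
... | tri> _ _ x<b = trans
  (cong₂ _+_ (cong length (filter-reject (_<? x) (<-asym x<b))) (cong length (filter-accept (x <?_) x<b)))
  (trans (+-suc _ _) (cong suc (rank+above≡length x B x≢B)))

rankSum-∷ : ∀ {N} (x : Fin N) U zs → rankSum (x ∷ U) zs ≡ rankSum U zs + length (filter (x <?_) zs)
rankSum-∷ x U []       = refl
rankSum-∷ x U (z ∷ zs) with does (x <? z)
... | true  = trans (cong (λ s → suc (rank U z + s)) (rankSum-∷ x U zs)) (regroup (rank U z) _ _)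
  where
  regroup : ∀ r s f → suc (r + (s + f)) ≡ r + s + suc f
  regroup = solve-∀
... | false = trans (cong (_+_ (rank U z)) (rankSum-∷ x U zs)) (sym (+-assoc (rank U z) _ _))

rankSum-map-suc : ∀ {N} (U zs : List (Fin N)) → rankSum (map suc U) (map suc zs) ≡ rankSum U zs
rankSum-map-suc U []       = refl
rankSum-map-suc U (z ∷ zs) = cong₂ _+_ (rank-map-suc U z) (rankSum-map-suc U zs)

rankSum-zero∷map-suc : ∀ {N} (U zs : List (Fin N)) →
  rankSum (zero ∷ map suc U) (map suc zs) ≡ length zs + rankSum U zs
rankSum-zero∷map-suc U []       = refl
rankSum-zero∷map-suc U (z ∷ zs) = cong suc (begin
  rank (map suc U) (suc z) + rankSum (zero ∷ map suc U) (map suc zs)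
    ≡⟨ cong₂ _+_ (rank-map-suc U z) (rankSum-zero∷map-suc U zs) ⟩
  rank U z + (length zs + rankSum U zs)
    ≡⟨ sym (+-assoc (rank U z) _ _) ⟩
  rank U z + length zs + rankSum U zs
    ≡⟨ cong (_+ rankSum U zs) (+-comm (rank U z) (length zs)) ⟩
  length zs + rank U z + rankSum U zs
    ≡⟨ +-assoc (length zs) _ _ ⟩
  length zs + (rank U z + rankSum U zs) ∎)
  where open ≡-Reasoning

replace-↭ : ∀ {A : Set} I (c B : List A) → length I ≡ length c → length B ≡ weight I →
  replace I c B ↭ select (map not I) c ++ B
replace-↭ []          []      []      _ _ = ↭.refl
replace-↭ (true ∷ I)  (x ∷ c) (b ∷ B) l w = ↭.trans
  (↭.prep b (replace-↭ I c B (suc-injective l) (suc-injective w)))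
  (↭.↭-sym (shift b (select (map not I) c) B))
replace-↭ (false ∷ I) (x ∷ c) B       l w = ↭.prep x (replace-↭ I c B (suc-injective l) w)

rank-replace : ∀ {N} I (c B : List (Fin N)) z → length I ≡ length c → length B ≡ weight I →
  rank (replace I c B) z ≡ rank (select (map not I) c) z + rank B z
rank-replace I c B z l w =
  trans (↭-length (filter-↭ (_<? z) (replace-↭ I c B l w))) (rank-++ (select (map not I) c) B z)

entrySet-replace : ∀ {N} I (c B : List (Fin N)) → length I ≡ length c → length B ≡ weight I →
  entrySet (replace I c B) ≡ entrySet (select (map not I) c) ∪ entrySet B
entrySet-replace I c B l w = trans (entrySet-↭ (replace-↭ I c B l w)) (entrySet-++ (select (map not I) c) B)

-- The k-th incoming entry, put into the slot of the k-th outgoing one, is inverted exactly with the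
-- entries of U strictly between the two, and their number is the difference of the two ranks in U.
inversions-replace : ∀ {N} I (c B : List (Fin N)) → AllPairs _<_ c → AllPairs _<_ B →
  All (λ x → All (x ≢_) B) c → length I ≡ length c → length B ≡ weight I →
  let U = select (map not I) c in
  sgn (inversions (replace I c B)) ≡ sgn (rankSum U (select I c) + rankSum U B)
inversions-replace []          []      []      _ _ _ _ _ = refl
inversions-replace (true ∷ I)  (x ∷ c) (b ∷ B) (x<c ∷ c↑) (b<B ∷ B↑) c#B l w = begin
  sgn (rank (replace I c B) b + inversions (replace I c B))
    ≡⟨ cong (λ r → sgn (r + inversions (replace I c B))) rank-b ⟩
  sgn (rank U b + inversions (replace I c B))
    ≡⟨ sgn-+-congˡ (rank U b)
         (inversions-replace I c B c↑ B↑ (All.map All.tail (All.tail c#B)) (suc-injective l) (suc-injective w)) ⟩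
  sgn (rank U b + (rankSum U (select I c) + rankSum U B))
    ≡⟨ cong sgn (regroup (rank U b) (rankSum U (select I c)) (rankSum U B)) ⟩
  sgn (0 + rankSum U (select I c) + (rank U b + rankSum U B))
    ≡⟨ cong (λ r → sgn (r + rankSum U (select I c) + (rank U b + rankSum U B)))
         (sym (rank-above (All-select (map not I) x<c))) ⟩
  sgn (rank U x + rankSum U (select I c) + (rank U b + rankSum U B)) ∎
  where
  open ≡-Reasoning
  U = select (map not I) c
  rank-b : rank (replace I c B) b ≡ rank U b
  rank-b = trans (rank-replace I c B b (suc-injective l) (suc-injective w))
                 (trans (cong (_+_ (rank U b)) (rank-above b<B)) (+-identityʳ (rank U b)))
  regroup : ∀ r a β → r + (a + β) ≡ 0 + a + (r + β)
  regroup = solve-∀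
inversions-replace (false ∷ I) (x ∷ c) B       (x<c ∷ c↑) B↑         (x#B ∷ c#B) l w = begin
  sgn (rank (replace I c B) x + inversions (replace I c B))
    ≡⟨ cong (λ r → sgn (r + inversions (replace I c B))) rank-x ⟩
  sgn (lt + inversions (replace I c B))
    ≡⟨ sgn-+-congˡ lt (inversions-replace I c B c↑ B↑ c#B (suc-injective l) w) ⟩
  sgn (lt + (rankSum U (select I c) + rankSum U B))
    ≡⟨ sym (sgn-+-double (lt + (rankSum U (select I c) + rankSum U B)) gt) ⟩
  sgn (lt + (rankSum U (select I c) + rankSum U B) + (gt + gt))
    ≡⟨ cong sgn (regroup lt (rankSum U (select I c)) (rankSum U B) gt) ⟩
  sgn (rankSum U (select I c) + (lt + gt) + (rankSum U B + gt))
    ≡⟨ cong (λ k → sgn (rankSum U (select I c) + k + (rankSum U B + gt))) (sym above-x) ⟩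
  sgn (rankSum U (select I c) + length (filter (x <?_) (select I c)) + (rankSum U B + gt))
    ≡⟨ sym (cong₂ (λ p q → sgn (p + q)) (rankSum-∷ x U (select I c)) (rankSum-∷ x U B)) ⟩
  sgn (rankSum (x ∷ U) (select I c) + rankSum (x ∷ U) B) ∎
  where
  open ≡-Reasoning
  U  = select (map not I) c
  lt = rank B x
  gt = length (filter (x <?_) B)
  rank-x : rank (replace I c B) x ≡ lt
  rank-x = trans (rank-replace I c B x (suc-injective l) w) (cong (_+ lt) (rank-above (All-select (map not I) x<c)))
  above-x : length (filter (x <?_) (select I c)) ≡ lt + gt
  above-x = begin
    length (filter (x <?_) (select I c)) ≡⟨ cong length (filter-all (x <?_) (All-select I x<c)) ⟩
    length (select I c)                  ≡⟨ length-select I c (suc-injective l) ⟩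
    weight I                             ≡⟨ sym w ⟩
    length B                             ≡⟨ sym (rank+above≡length x B x#B) ⟩
    lt + gt                              ∎
  regroup : ∀ lt a β gt → lt + (a + β) + (gt + gt) ≡ a + (lt + gt) + (β + gt)
  regroup = solve-∀

lowerPairs : ∀ {N} → Subset N → Subset N → ℕ
lowerPairs []          []      = 0
lowerPairs (true ∷ X)  (_ ∷ Y) = ∣ Y ∣ + lowerPairs X Y
lowerPairs (false ∷ X) (_ ∷ Y) = lowerPairs X Y

rankSum-elems : ∀ {N} (X Y : Subset N) → rankSum (elems X) (elems Y) ≡ lowerPairs X Y
rankSum-elems []      []      = refl
rankSum-elems (x ∷ X) (y ∷ Y) = trans (drop-zero y) (shifted x)
  where
  drop-zero : ∀ y → rankSum (elems (x ∷ X)) (elems (y ∷ Y)) ≡ rankSum (elems (x ∷ X)) (map suc (elems Y))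
  drop-zero true  = cong (_+ rankSum (elems (x ∷ X)) (map suc (elems Y))) (rank-zero (elems (x ∷ X)))
  drop-zero false = refl
  shifted : ∀ x → rankSum (elems (x ∷ X)) (map suc (elems Y)) ≡ lowerPairs (x ∷ X) (y ∷ Y)
  shifted true  = trans (rankSum-zero∷map-suc (elems X) (elems Y)) (cong₂ _+_ (length-elems Y) (rankSum-elems X Y))
  shifted false = trans (rankSum-map-suc (elems X) (elems Y)) (rankSum-elems X Y)

elems-disjoint : ∀ {N} {X Z : Subset N} → Z ⊆ ∁ X → All (λ x → All (x ≢_) (elems Z)) (elems X)
elems-disjoint {X = X} {Z} Z⊆∁X = All.tabulate λ x∈X → All.tabulate λ { z∈Z refl →
  x∈p⇒x∉∁p (∈-elems X x∈X) (Z⊆∁X (∈-elems Z z∈Z)) }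

inversions-swapped : ∀ {N} {X Y Z : Subset N} → Y ⊆ X → Z ⊆ ∁ X → ∣ Z ∣ ≡ ∣ Y ∣ →
  sgn (inversions (replace (positions X Y) (elems X) (elems Z)))
    ≡ sgn (lowerPairs (X ─ Y) Y + lowerPairs (X ─ Y) Z)
inversions-swapped {X = X} {Y} {Z} Y⊆X Z⊆∁X ∣Z∣≡∣Y∣ = begin
  sgn (inversions (replace I (elems X) (elems Z)))
    ≡⟨ inversions-replace I (elems X) (elems Z) (elems-sorted X) (elems-sorted Z) (elems-disjoint Z⊆∁X)
         (trans (length-positions X Y) (sym (length-elems X)))
         (trans (length-elems Z) (trans ∣Z∣≡∣Y∣ (sym (weight-positions Y⊆X)))) ⟩
  sgn (rankSum (select (map not I) (elems X)) (select I (elems X)) + rankSum (select (map not I) (elems X)) (elems Z))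
    ≡⟨ cong₂ (λ U W → sgn (rankSum U W + rankSum U (elems Z))) (select-not-positions Y⊆X) (select-positions Y⊆X) ⟩
  sgn (rankSum (elems (X ─ Y)) (elems Y) + rankSum (elems (X ─ Y)) (elems Z))
    ≡⟨ cong₂ (λ p q → sgn (p + q)) (rankSum-elems (X ─ Y) Y) (rankSum-elems (X ─ Y) Z) ⟩
  sgn (lowerPairs (X ─ Y) Y + lowerPairs (X ─ Y) Z) ∎
  where
  open ≡-Reasoning
  I = positions X Y

triangle : ℕ → ℕ
triangle zero    = 0
triangle (suc k) = triangle k + suc k

triangle-double : ∀ k → triangle (k + k) + k ≡ (k * k + k) + (k * k + k)
triangle-double zero    = refl
triangle-double (suc k) = begin
  triangle (suc k + suc k) + suc k
    ≡⟨ cong (λ j → triangle (suc j) + suc k) (+-suc k k) ⟩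
  triangle (k + k) + suc (k + k) + suc (suc (k + k)) + suc k
    ≡⟨ regroup (triangle (k + k)) k ⟩
  triangle (k + k) + k + 4 * suc k
    ≡⟨ cong (_+ 4 * suc k) (triangle-double k) ⟩
  (k * k + k) + (k * k + k) + 4 * suc k
    ≡⟨ complete-square k ⟩
  (suc k * suc k + suc k) + (suc k * suc k + suc k) ∎
  where
  open ≡-Reasoning
  regroup : ∀ t k → t + suc (k + k) + suc (suc (k + k)) + suc k ≡ t + k + 4 * suc k
  regroup = solve-∀
  complete-square : ∀ k → (k * k + k) + (k * k + k) + 4 * suc k ≡ (suc k * suc k + suc k) + (suc k * suc k + suc k)
  complete-square = solve-∀

elemSum-map-suc : ∀ {N} (xs : List (Fin N)) →
  sumℕ (map (suc ∘ toℕ) (map suc xs)) ≡ sumℕ (map (suc ∘ toℕ) xs) + length xs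
elemSum-map-suc []       = refl
elemSum-map-suc (x ∷ xs) =
  trans (cong (λ s → suc (suc (toℕ x) + s)) (elemSum-map-suc xs)) (regroup (suc (toℕ x)) _ _)
  where
  regroup : ∀ a s l → suc (a + (s + l)) ≡ a + s + suc l
  regroup = solve-∀

elemSum-tail : ∀ {N} (X : Subset (suc N)) → elemSum X ≡ elemSum (tail X) + ∣ X ∣
elemSum-tail (true ∷ Y)  = trans (cong suc shifted) (sym (+-suc (elemSum Y) ∣ Y ∣))
  where shifted = trans (elemSum-map-suc (elems Y)) (cong (_+_ (elemSum Y)) (length-elems Y))
elemSum-tail (false ∷ Y) = trans (elemSum-map-suc (elems Y)) (cong (_+_ (elemSum Y)) (length-elems Y))

-- The number of pairs w < z with z ∈ X = (S ─ T) ∪ (T ─ S) and w ∉ X.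
crossings : ∀ {N} → Subset N → Subset N → ℕ
crossings S T = (lowerPairs (S ─ A) A + lowerPairs (S ─ A) B) + (lowerPairs (∁ S ─ B) B + lowerPairs (∁ S ─ B) A)
  where
  A = S ─ T
  B = T ─ S

module _ {N} (S T : Subset N) where
  private
    A = S ─ T
    B = T ─ S
    p₁ = lowerPairs (S ─ A) A
    p₂ = lowerPairs (S ─ A) B
    p₃ = lowerPairs (∁ S ─ B) B
    p₄ = lowerPairs (∁ S ─ B) A
    τ  = triangle (∣ A ∣ + ∣ B ∣)

  crossings-∷ : ∀ s t → let A′ = (s ∷ S) ─ (t ∷ T); B′ = (t ∷ T) ─ (s ∷ S) in
    crossings (s ∷ S) (t ∷ T) + triangle (∣ A′ ∣ + ∣ B′ ∣) ≡ crossings S T + τ + (∣ A′ ∣ + ∣ B′ ∣)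
  crossings-∷ true  true  = regroup ∣ A ∣ ∣ B ∣ p₁ p₂ p₃ p₄ τ
    where
    regroup : ∀ a b p₁ p₂ p₃ p₄ τ → ((a + p₁) + (b + p₂)) + (p₃ + p₄) + τ ≡ (p₁ + p₂) + (p₃ + p₄) + τ + (a + b)
    regroup = solve-∀
  crossings-∷ false false = regroup ∣ A ∣ ∣ B ∣ p₁ p₂ p₃ p₄ τ
    where
    regroup : ∀ a b p₁ p₂ p₃ p₄ τ → (p₁ + p₂) + ((b + p₃) + (a + p₄)) + τ ≡ (p₁ + p₂) + (p₃ + p₄) + τ + (a + b)
    regroup = solve-∀
  crossings-∷ true  false = sym (+-assoc (crossings S T) τ (suc (∣ A ∣ + ∣ B ∣)))
  crossings-∷ false true  = triangle-step (crossings S T) ∣ A ∣ ∣ B ∣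
    where
    triangle-step : ∀ c a b → c + triangle (a + suc b) ≡ c + triangle (a + b) + (a + suc b)
    triangle-step c a b rewrite +-suc a b = sym (+-assoc c (triangle (a + b)) (suc (a + b)))

-- The j-th smallest element z of X = (S ─ T) ∪ (T ─ S) is j plus the number of elements of ∁ X below z.
crossings+triangle : ∀ {N} (S T : Subset N) →
  crossings S T + triangle (∣ S ─ T ∣ + ∣ T ─ S ∣) ≡ elemSum (S ─ T) + elemSum (T ─ S)
crossings+triangle []      []      = refl
crossings+triangle (s ∷ S) (t ∷ T) = begin
  crossings (s ∷ S) (t ∷ T) + triangle (∣ A ∣ + ∣ B ∣)
    ≡⟨ crossings-∷ S T s t ⟩
  crossings S T + triangle (∣ S ─ T ∣ + ∣ T ─ S ∣) + (∣ A ∣ + ∣ B ∣)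
    ≡⟨ cong (_+ (∣ A ∣ + ∣ B ∣)) (crossings+triangle S T) ⟩
  elemSum (S ─ T) + elemSum (T ─ S) + (∣ A ∣ + ∣ B ∣)
    ≡⟨ regroup (elemSum (S ─ T)) (elemSum (T ─ S)) ∣ A ∣ ∣ B ∣ ⟩
  (elemSum (S ─ T) + ∣ A ∣) + (elemSum (T ─ S) + ∣ B ∣)
    ≡⟨ sym (cong₂ _+_ (elemSum-tail A) (elemSum-tail B)) ⟩
  elemSum A + elemSum B ∎
  where
  open ≡-Reasoning
  A = (s ∷ S) ─ (t ∷ T)
  B = (t ∷ T) ─ (s ∷ S)
  regroup : ∀ e f a b → e + f + (a + b) ≡ (e + a) + (f + b)
  regroup = solve-∀

-- Column tabloids

tabloid-≢ : ∀ {N} (t : Tableau N) {T} → entrySet (col1 t) ≢ T → [ t ] T ≡ + 0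
tabloid-≢ t {T} ≢T = cong (λ b → if b then sgn (inversions (col1 t) + inversions (col2 t)) else + 0)
  (dec-false (≡-dec Bool._≟_ (entrySet (col1 t)) T) ≢T)

tabloid-≡ : ∀ {N} (t : Tableau N) {T} → entrySet (col1 t) ≡ T →
  [ t ] T ≡ sgn (inversions (col1 t) + inversions (col2 t))
tabloid-≡ t {T} ≡T = cong (λ b → if b then sgn (inversions (col1 t) + inversions (col2 t)) else + 0)
  (dec-true (≡-dec Bool._≟_ (entrySet (col1 t)) T) ≡T)

inversions-sorted : ∀ {N} {xs : List (Fin N)} → AllPairs _<_ xs → inversions xs ≡ 0
inversions-sorted []            = refl
inversions-sorted (x<xs ∷ xs↑) = cong₂ _+_ (rank-above x<xs) (inversions-sorted xs↑)

[tabOf]-diagonal : ∀ {N} (S : Subset N) → [ tabOf S ] S ≡ + 1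
[tabOf]-diagonal S = trans (tabloid-≡ (tabOf S) (entrySet-elems S))
  (cong sgn (cong₂ _+_ (inversions-sorted (elems-sorted S)) (inversions-sorted (elems-sorted (∁ S)))))

[tabOf]-off : ∀ {N} {S T : Subset N} → S ≢ T → [ tabOf S ] T ≡ + 0
[tabOf]-off {S = S} S≢T = tabloid-≢ (tabOf S) (S≢T ∘ trans (sym (entrySet-elems S)))

entrySet-swapped : ∀ {N} (S : Subset N) I J → length I ≡ ∣ S ∣ → length J ≡ ∣ ∁ S ∣ → weight J ≡ weight I →
  entrySet (col1 (swapTab I J (tabOf S))) ≡ (S ─ selectₛ I S) ∪ selectₛ J (∁ S)
entrySet-swapped S I J lI lJ w = begin
  entrySet (replace I (elems S) (select J (elems (∁ S))))
    ≡⟨ entrySet-replace I (elems S) (select J (elems (∁ S))) (trans lI (sym (length-elems S)))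
         (trans (length-select J (elems (∁ S)) (trans lJ (sym (length-elems (∁ S))))) w) ⟩
  entrySet (select (map not I) (elems S)) ∪ entrySet (select J (elems (∁ S)))
    ≡⟨ cong₂ (λ X Y → entrySet X ∪ entrySet Y)
         (select-elems (map not I) S (trans (length-map not I) lI)) (select-elems J (∁ S) lJ) ⟩
  entrySet (elems (selectₛ (map not I) S)) ∪ entrySet (elems (selectₛ J (∁ S)))
    ≡⟨ cong₂ _∪_ (entrySet-elems (selectₛ (map not I) S)) (entrySet-elems (selectₛ J (∁ S))) ⟩
  selectₛ (map not I) S ∪ selectₛ J (∁ S)
    ≡⟨ cong (_∪ selectₛ J (∁ S)) (selectₛ-not I S lI) ⟩
  (S ─ selectₛ I S) ∪ selectₛ J (∁ S) ∎
  where open ≡-Reasoning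

swapped-masks : ∀ {N} (S T : Subset N) I J → length I ≡ ∣ S ∣ → length J ≡ ∣ ∁ S ∣ → weight J ≡ weight I →
  entrySet (col1 (swapTab I J (tabOf S))) ≡ T → (I , J) ≡ (positions S (S ─ T) , positions (∁ S) (T ─ S))
swapped-masks S T I J lI lJ w ≡T = cong₂ _,_
  (trans (sym (positions-selectₛ I S lI)) (cong (positions S) (sym S─T≡A)))
  (trans (sym (positions-selectₛ J (∁ S) lJ)) (cong (positions (∁ S)) (sym T─S≡B)))
  where
  A = selectₛ I S
  B = selectₛ J (∁ S)
  [S─A]∪B≡T : (S ─ A) ∪ B ≡ T
  [S─A]∪B≡T = trans (sym (entrySet-swapped S I J lI lJ w)) ≡T
  S─T≡A : S ─ T ≡ A
  S─T≡A = subst (λ X → S ─ X ≡ A) [S─A]∪B≡T (proj₁ (─-∪-cancel (selectₛ-⊆ I S) (selectₛ-⊆ J (∁ S))))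
  T─S≡B : T ─ S ≡ B
  T─S≡B = subst (λ X → X ─ S ≡ B) [S─A]∪B≡T (proj₂ (─-∪-cancel (selectₛ-⊆ I S) (selectₛ-⊆ J (∁ S))))

swapped-sign : ∀ {N} (S T : Subset N) → ∣ T ─ S ∣ ≡ ∣ S ─ T ∣ →
  [ swapTab (positions S (S ─ T)) (positions (∁ S) (T ─ S)) (tabOf S) ] T
    ≡ sgn (elemSum (S ─ T) + elemSum (T ─ S) + ∣ S ─ T ∣)
swapped-sign S T ∣B∣≡∣A∣ = begin
  [ swapTab I₀ J₀ (tabOf S) ] T
    ≡⟨ tabloid-≡ (swapTab I₀ J₀ (tabOf S)) col1≡T ⟩
  sgn (inversions (replace I₀ (elems S) (select J₀ (elems (∁ S))))
       + inversions (replace J₀ (elems (∁ S)) (select I₀ (elems S))))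
    ≡⟨ cong₂ (λ B′ A′ → sgn (inversions (replace I₀ (elems S) B′) + inversions (replace J₀ (elems (∁ S)) A′)))
         (select-positions B⊆∁S) (select-positions A⊆S) ⟩
  sgn (inv₁ + inv₂)
    ≡⟨ sgn-+-cong {inv₁} {inv₂} {crossings₁} {crossings₂}
         (inversions-swapped A⊆S B⊆∁S ∣B∣≡∣A∣) (inversions-swapped B⊆∁S A⊆∁∁S (sym ∣B∣≡∣A∣)) ⟩
  sgn (crossings S T)
    ≡⟨ sym (sgn-+-double (crossings S T) (∣ A ∣ * ∣ A ∣ + ∣ A ∣)) ⟩
  sgn (crossings S T + ((∣ A ∣ * ∣ A ∣ + ∣ A ∣) + (∣ A ∣ * ∣ A ∣ + ∣ A ∣)))
    ≡⟨ cong (λ k → sgn (crossings S T + k)) (sym (triangle-double ∣ A ∣)) ⟩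
  sgn (crossings S T + (triangle (∣ A ∣ + ∣ A ∣) + ∣ A ∣))
    ≡⟨ cong (λ k → sgn (crossings S T + (triangle (∣ A ∣ + k) + ∣ A ∣))) (sym ∣B∣≡∣A∣) ⟩
  sgn (crossings S T + (triangle (∣ A ∣ + ∣ B ∣) + ∣ A ∣))
    ≡⟨ cong sgn (sym (+-assoc (crossings S T) _ ∣ A ∣)) ⟩
  sgn (crossings S T + triangle (∣ A ∣ + ∣ B ∣) + ∣ A ∣)
    ≡⟨ cong (λ k → sgn (k + ∣ A ∣)) (crossings+triangle S T) ⟩
  sgn (elemSum A + elemSum B + ∣ A ∣) ∎
  where
  open ≡-Reasoning
  A = S ─ T
  B = T ─ S
  I₀ = positions S A
  J₀ = positions (∁ S) B
  A⊆S : A ⊆ S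
  A⊆S = p─q⊆p S T
  B⊆∁S : B ⊆ ∁ S
  B⊆∁S = q─p⊆∁p S T
  inv₁ = inversions (replace I₀ (elems S) (elems B))
  inv₂ = inversions (replace J₀ (elems (∁ S)) (elems A))
  crossings₁ = lowerPairs (S ─ A) A + lowerPairs (S ─ A) B
  crossings₂ = lowerPairs (∁ S ─ B) B + lowerPairs (∁ S ─ B) A
  A⊆∁∁S : A ⊆ ∁ (∁ S)
  A⊆∁∁S x∈A = p⊆∁∁p S (A⊆S x∈A)
  col1≡T : entrySet (col1 (swapTab I₀ J₀ (tabOf S))) ≡ T
  col1≡T = begin
    entrySet (col1 (swapTab I₀ J₀ (tabOf S)))
      ≡⟨ entrySet-swapped S I₀ J₀ (length-positions S A) (length-positions (∁ S) B)
           (trans (weight-positions B⊆∁S) (trans ∣B∣≡∣A∣ (sym (weight-positions A⊆S)))) ⟩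
    (S ─ selectₛ I₀ S) ∪ selectₛ J₀ (∁ S)
      ≡⟨ cong₂ (λ X Y → (S ─ X) ∪ Y) (selectₛ-positions A⊆S) (selectₛ-positions B⊆∁S) ⟩
    (S ─ A) ∪ B
      ≡⟨ p─[p─q]∪[q─p]≡q S T ⟩
    T ∎

-- η n m ℓ t T unfolds to + (m C ℓ) *ℤ [ t ] T - swapSum n m ℓ t T.
swapSum : ∀ {N} (a b ℓ : ℕ) → Tableau N → Mμ N
swapSum a b ℓ t T =
  sumℤ (foldr (λ I acc → map (λ J → [ swapTab I J t ] T) (choose b ℓ) ++ acc) [] (choose a ℓ))

module _ {N} {a b ℓ : ℕ} (S T : Subset N) (∣S∣≡a : ∣ S ∣ ≡ a) (∣∁S∣≡b : ∣ ∁ S ∣ ≡ b) where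
  private
    swapTerm : List Bool → List Bool → ℤ
    swapTerm I J = [ swapTab I J (tabOf S) ] T
    I₀ = positions S (S ─ T)
    J₀ = positions (∁ S) (T ─ S)

    swapTerm-vanishing : ∀ I J → Mask a ℓ I → Mask b ℓ J → (I , J) ≢ (I₀ , J₀) → swapTerm I J ≡ + 0
    swapTerm-vanishing I J (lI , wI) (lJ , wJ) ≢I₀J₀ = tabloid-≢ (swapTab I J (tabOf S))
      (≢I₀J₀ ∘ swapped-masks S T I J (trans lI (sym ∣S∣≡a)) (trans lJ (sym ∣∁S∣≡b)) (trans wJ (sym wI)))

  swapSum-vanishing : ∣ S ─ T ∣ ≢ ℓ → swapSum a b ℓ (tabOf S) T ≡ + 0
  swapSum-vanishing ∣S─T∣≢ℓ = trans (sumℤ-foldr-++ swapTerm (choose a ℓ) (choose b ℓ))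
    (sum-choose-vanishing a ℓ _ λ I mI → sum-choose-vanishing b ℓ _ λ J mJ →
      swapTerm-vanishing I J mI mJ λ IJ≡I₀J₀ → ∣S─T∣≢ℓ
        (trans (sym (weight-positions (p─q⊆p S T))) (trans (cong (weight ∘ proj₁) (sym IJ≡I₀J₀)) (proj₂ mI))))

  swapSum-adjacent : ∣ S ─ T ∣ ≡ ℓ → ∣ T ─ S ∣ ≡ ℓ →
    swapSum a b ℓ (tabOf S) T ≡ sgn (elemSum (S ─ T) + elemSum (T ─ S) + ℓ)
  swapSum-adjacent ∣S─T∣≡ℓ ∣T─S∣≡ℓ = begin
    swapSum a b ℓ (tabOf S) T
      ≡⟨ sumℤ-foldr-++ swapTerm (choose a ℓ) (choose b ℓ) ⟩
    sumℤ (map (λ I → sumℤ (map (swapTerm I) (choose b ℓ))) (choose a ℓ))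
      ≡⟨ sum-choose-single a ℓ _ mI₀ (λ I mI I≢I₀ →
           sum-choose-vanishing b ℓ _ λ J mJ → swapTerm-vanishing I J mI mJ (I≢I₀ ∘ cong proj₁)) ⟩
    sumℤ (map (swapTerm I₀) (choose b ℓ))
      ≡⟨ sum-choose-single b ℓ _ mJ₀ (λ J mJ J≢J₀ → swapTerm-vanishing I₀ J mI₀ mJ (J≢J₀ ∘ cong proj₂)) ⟩
    swapTerm I₀ J₀
      ≡⟨ swapped-sign S T (trans ∣T─S∣≡ℓ (sym ∣S─T∣≡ℓ)) ⟩
    sgn (elemSum (S ─ T) + elemSum (T ─ S) + ∣ S ─ T ∣)
      ≡⟨ cong (λ k → sgn (elemSum (S ─ T) + elemSum (T ─ S) + k)) ∣S─T∣≡ℓ ⟩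
    sgn (elemSum (S ─ T) + elemSum (T ─ S) + ℓ) ∎
    where
    open ≡-Reasoning
    mI₀ : Mask a ℓ I₀
    mI₀ = trans (length-positions S (S ─ T)) ∣S∣≡a , trans (weight-positions (p─q⊆p S T)) ∣S─T∣≡ℓ
    mJ₀ : Mask b ℓ J₀
    mJ₀ = trans (length-positions (∁ S) (T ─ S)) ∣∁S∣≡b , trans (weight-positions (q─p⊆∁p S T)) ∣T─S∣≡ℓ

∣∁p∣≡m : ∀ {n m} (p : Subset (n + m)) → ∣ p ∣ ≡ n → ∣ ∁ p ∣ ≡ m
∣∁p∣≡m {n} {m} p ∣p∣≡n = trans (∣∁p∣≡n∸∣p∣ p) (trans (cong (n + m ∸_) ∣p∣≡n) (m+n∸m≡n n m))

∣p─q∣≡ℓ⇒∣p∩q∣≡n∸ℓ : ∀ {N} {n ℓ} (p q : Subset N) → ∣ p ∣ ≡ n → ∣ p ─ q ∣ ≡ ℓ → ∣ p ∩ q ∣ ≡ n ∸ ℓ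
∣p─q∣≡ℓ⇒∣p∩q∣≡n∸ℓ p q ∣p∣≡n ∣p─q∣≡ℓ = trans (∣p∩q∣≡∣p∣∸∣p─q∣ p q) (cong₂ _∸_ ∣p∣≡n ∣p─q∣≡ℓ)

∣p∩q∣≡n∸ℓ⇒∣p─q∣≡ℓ : ∀ {N} {n ℓ} (p q : Subset N) → ∣ p ∣ ≡ n → ℓ ≤ n → ∣ p ∩ q ∣ ≡ n ∸ ℓ → ∣ p ─ q ∣ ≡ ℓ
∣p∩q∣≡n∸ℓ⇒∣p─q∣≡ℓ p q ∣p∣≡n ℓ≤n ∣p∩q∣≡n∸ℓ =
  trans (∣p─q∣≡∣p∣∸∣p∩q∣ p q) (trans (cong₂ _∸_ ∣p∣≡n ∣p∩q∣≡n∸ℓ) (m∸[m∸n]≡n ℓ≤n))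

lemma3p2 : (n m ℓ : ℕ) → 1 ≤ ℓ → ℓ ≤ m → m ≤ n →
    (S T : Subset (n + m)) → ∣ S ∣ ≡ n → ∣ T ∣ ≡ n →
    (S ≡ T → η n m ℓ (tabOf S) T ≡ + (m C ℓ))
    × (S ≢ T → ∣ S ∩ T ∣ ≢ n ∸ ℓ → η n m ℓ (tabOf S) T ≡ + 0)
    × (∣ S ∩ T ∣ ≡ n ∸ ℓ →
         η n m ℓ (tabOf S) T ≡ sgn (elemSum (S ─ T) + elemSum (T ─ S) + ℓ + 1))
lemma3p2 n m ℓ 1≤ℓ ℓ≤m m≤n S T ∣S∣≡n ∣T∣≡n = diagonal , off-diagonal , adjacent
  where
  open ≡-Reasoning
  ∣∁S∣≡m : ∣ ∁ S ∣ ≡ m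
  ∣∁S∣≡m = ∣∁p∣≡m S ∣S∣≡n
  η≡ : ∀ {x y} → [ tabOf S ] T ≡ x → swapSum n m ℓ (tabOf S) T ≡ y →
    η n m ℓ (tabOf S) T ≡ + (m C ℓ) *ℤ x - y
  η≡ = cong₂ (λ x y → + (m C ℓ) *ℤ x - y)
  ∣S─S∣≢ℓ : ∣ S ─ S ∣ ≢ ℓ
  ∣S─S∣≢ℓ ∣S─S∣≡ℓ = <⇒≢ 1≤ℓ (trans (sym (∣p─p∣≡0 S)) ∣S─S∣≡ℓ)

  diagonal : S ≡ T → η n m ℓ (tabOf S) T ≡ + (m C ℓ)
  diagonal refl = trans (η≡ ([tabOf]-diagonal S) (swapSum-vanishing S S ∣S∣≡n ∣∁S∣≡m ∣S─S∣≢ℓ))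
    (trans (ℤ.+-identityʳ (+ (m C ℓ) *ℤ + 1)) (ℤ.*-identityʳ (+ (m C ℓ))))

  off-diagonal : S ≢ T → ∣ S ∩ T ∣ ≢ n ∸ ℓ → η n m ℓ (tabOf S) T ≡ + 0
  off-diagonal S≢T ∣S∩T∣≢n∸ℓ = trans (η≡ ([tabOf]-off S≢T)
      (swapSum-vanishing S T ∣S∣≡n ∣∁S∣≡m (∣S∩T∣≢n∸ℓ ∘ ∣p─q∣≡ℓ⇒∣p∩q∣≡n∸ℓ S T ∣S∣≡n)))
    (trans (ℤ.+-identityʳ (+ (m C ℓ) *ℤ + 0)) (ℤ.*-zeroʳ (+ (m C ℓ))))

  adjacent : ∣ S ∩ T ∣ ≡ n ∸ ℓ →
    η n m ℓ (tabOf S) T ≡ sgn (elemSum (S ─ T) + elemSum (T ─ S) + ℓ + 1)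
  adjacent ∣S∩T∣≡n∸ℓ = begin
    η n m ℓ (tabOf S) T         ≡⟨ η≡ ([tabOf]-off S≢T) (swapSum-adjacent S T ∣S∣≡n ∣∁S∣≡m ∣S─T∣≡ℓ ∣T─S∣≡ℓ) ⟩
    + (m C ℓ) *ℤ + 0 - sgn E+ℓ  ≡⟨ cong (_- sgn E+ℓ) (ℤ.*-zeroʳ (+ (m C ℓ))) ⟩
    + 0 - sgn E+ℓ               ≡⟨ ℤ.+-identityˡ (- sgn E+ℓ) ⟩
    sgn (1 + E+ℓ)               ≡⟨ cong sgn (+-comm 1 E+ℓ) ⟩
    sgn (E+ℓ + 1)               ∎
    where
    E+ℓ = elemSum (S ─ T) + elemSum (T ─ S) + ℓ
    ∣S─T∣≡ℓ : ∣ S ─ T ∣ ≡ ℓ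
    ∣S─T∣≡ℓ = ∣p∩q∣≡n∸ℓ⇒∣p─q∣≡ℓ S T ∣S∣≡n (≤-trans ℓ≤m m≤n) ∣S∩T∣≡n∸ℓ
    ∣T─S∣≡ℓ : ∣ T ─ S ∣ ≡ ℓ
    ∣T─S∣≡ℓ = ∣p∩q∣≡n∸ℓ⇒∣p─q∣≡ℓ T S ∣T∣≡n (≤-trans ℓ≤m m≤n)
      (trans (cong ∣_∣ (∩-comm T S)) ∣S∩T∣≡n∸ℓ)
    S≢T : S ≢ T
    S≢T refl = ∣S─S∣≢ℓ ∣S─T∣≡ℓ
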